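{- Let $n\geq k\geq 3$ and let $f\colon\mathbb{F}_2^k\to\mathbb{F}_2$ be a $(k,n)$-lifting. Then the algebraic degree of $f$ satisfies $\deg(f)<k$.
   Context: For a Boolean function $f\colon\mathbb{F}_2^k\to\mathbb{F}_2$ and $n\geq k$, the map induced by $f$ on $\mathbb{F}_2^n$ is $F$ with $F(x)_i=f(x_i,\dotsc,x_{i+k-1})$ for $1\le i\le n$, indices modulo $n$ in $\{1,\dots,n\}$; $f$ is a $(k,n)$-lifting if $F$ is a bijection of $\mathbb{F}_2^n$. The algebraic degree of a Boolean function is the largest number of variables in a monomial of its (reduced) algebraic normal form. -}

module Defs where

open import Data.Bool using (Bool; true; false; _xor_; _∧_; if_then_else_)
open import Data.Nat using (ℕ; zero; suc; _+_; _<_; NonZero)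
open import Data.Nat.DivMod using (_mod_)
open import Data.Fin using (Fin; toℕ)
open import Data.Vec using (Vec; []; _∷_; lookup; tabulate; map; zipWith)
open import Data.List using (List; []; _∷_; _++_; foldr)
import Data.List as List
open import Data.Product using (Σ; _×_; ∃)
open import Relation.Binary.PropositionalEquality using (_≡_)
open import Function.Definitions using (Injective; Surjective)

-- Elements of F₂ are Bool (false = 0, true = 1); addition is xor, multiplication is ∧.
-- A Boolean function in k variables.
BoolFun : ℕ → Set
BoolFun k = Vec Bool k → Bool

-- The map F : F₂ⁿ → F₂ⁿ induced by f, with F(x)_i = f(x_i, …, x_{i+k-1}),
-- indices taken mod n (0-based here).
induced : ∀ {k} (n : ℕ) .{{_ : NonZero n}} → BoolFun k → Vec Bool n → Vec Bool n
induced {k} n f x =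
  tabulate λ (i : Fin n) → f (tabulate λ (j : Fin k) → lookup x ((toℕ i + toℕ j) mod n))

IsLifting : (k n : ℕ) .{{_ : NonZero n}} → BoolFun k → Set
IsLifting k n f =
  Injective _≡_ _≡_ (induced n f) × Surjective _≡_ _≡_ (induced n f)

allVecs : (m : ℕ) → List (Vec Bool m)
allVecs zero = [] ∷ []
allVecs (suc m) = List.map (false ∷_) (allVecs m) ++ List.map (true ∷_) (allVecs m)

-- Monomial x^S = ∏_{i ∈ S} x_i, with S ⊆ {1..k} given by its indicator vector.
monomial : ∀ {k} → Vec Bool k → Vec Bool k → Bool
monomial [] [] = true
monomial (false ∷ S) (_ ∷ x) = monomial S x
monomial (true ∷ S) (xi ∷ x) = xi ∧ monomial S x

card : ∀ {k} → Vec Bool k → ℕ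
card [] = 0
card (false ∷ S) = card S
card (true ∷ S) = suc (card S)

evalANF : ∀ {k} → (Vec Bool k → Bool) → Vec Bool k → Bool
evalANF {k} a x = foldr (λ S acc → (a S ∧ monomial S x) xor acc) false (allVecs k)

IsANF : ∀ {k} → BoolFun k → (Vec Bool k → Bool) → Set
IsANF f a = ∀ x → f x ≡ evalANF a x

-- deg(f) < d : the (reduced, unique) ANF of f has no monomial with ≥ d variables.
-- Formally: f has an ANF all of whose nonzero coefficients are on monomials
-- with fewer than d variables.
DegreeLessThan : ∀ {k} → BoolFun k → ℕ → Set
DegreeLessThan {k} f d =
  Σ (Vec Bool k → Bool) λ a → IsANF f a × (∀ S → a S ≡ true → card S < d)

-- The first coordinate of a bijection F of F₂ⁿ is balanced: it is 1 on exactly 2ⁿ⁻¹ points.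
-- For the map induced by f it is x ↦ f(x₁, …, x_k), which is 1 on 2ⁿ⁻ᵏ · wt(f) points, so
-- wt(f) = 2ᵏ⁻¹ is even as soon as k ≥ 2. The coefficient of x₁ ⋯ x_k in the algebraic normal
-- form of f is ⊕ₓ f(x) = wt(f) mod 2, so it vanishes and deg(f) < k.

{-# OPTIONS --with-K #-}
module Submission where

open import Defs
open import Data.Nat using (ℕ; _≤_; NonZero)
open import Data.Nat.Base using (zero; suc; _+_; _*_; _^_; _<_; s≤s; z≤n)
open import Data.Nat.Properties
  using (+-identityʳ; *-identityʳ; *-zeroʳ; *-assoc; *-comm; *-distribˡ-+; *-cancelˡ-≡; ^-distribˡ-+-*; m^n≢0;
         m≤n⇒m≤1+n; m≤n⇒m<n∨m≡n; m≤m+n; <-≤-trans; <-irrefl; suc-injective; m≤n⇒∃[o]m+o≡n)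
open import Data.Nat.DivMod using (_mod_; _%_; m<n⇒m%n≡m)
open import Data.Nat.ListAction using (sum)
open import Data.Nat.ListAction.Properties using (sum-++; sum-↭)
open import Data.Bool using (Bool; true; false; _xor_; _∧_; not)
open import Data.Bool.Properties
  using (∧-identityʳ; xor-assoc; xor-same; not-distribˡ-xor; xor-identityʳ; xor-∧-commutativeRing; ∧-commutativeMonoid)
open import Algebra.Bundles using (CommutativeRing; CommutativeMonoid)
open import Algebra.Properties.CommutativeSemigroup
  (CommutativeRing.+-commutativeSemigroup xor-∧-commutativeRing)
  using () renaming (interchange to xor-interchange)
open import Algebra.Properties.CommutativeSemigroup
  (CommutativeMonoid.commutativeSemigroup ∧-commutativeMonoid)
  using () renaming (x∙yz≈y∙xz to ∧-leftComm)
open import Data.Fin as Fin using (Fin; toℕ; inject≤)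
open import Data.Fin.Properties using (toℕ-injective; toℕ-fromℕ<; toℕ-inject≤; toℕ<n)
open import Data.Vec using (Vec; []; _∷_; lookup; tabulate; take; replicate)
open import Data.Vec.Properties
  using (∷-injectiveʳ; lookup∘tabulate; tabulate-cong; tabulate∘lookup; lookup-take-inject≤)
open import Data.List using (List; []; _∷_; _++_; map; foldr)
open import Data.List.Properties using (map-++; map-∘; map-cong)
open import Data.List.Membership.Propositional using (_∈_)
open import Data.List.Membership.Propositional.Properties using (∈-map⁺; ∈-map⁻; ∈-++⁺ˡ; ∈-++⁺ʳ)
open import Data.List.Membership.Propositional.Properties.WithK using (unique∧set⇒bag)
open import Data.List.Relation.Unary.Any using (here)
open import Data.List.Relation.Unary.All using ([])
open import Data.List.Relation.Unary.AllPairs using ([]; _∷_)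
open import Data.List.Relation.Unary.Unique.Propositional using (Unique)
import Data.List.Relation.Unary.Unique.Propositional.Properties as Unique
open import Data.List.Relation.Binary.BagAndSetEquality using (∼bag⇒↭)
open import Data.List.Relation.Binary.Permutation.Propositional using (_↭_)
import Data.List.Relation.Binary.Permutation.Propositional.Properties as Perm
open import Data.Product using (_×_; _,_; proj₁; proj₂)
open import Data.Sum using (inj₁; inj₂)
open import Data.Empty using (⊥-elim)
open import Relation.Nullary using (¬_)
open import Relation.Binary.PropositionalEquality
open import Function using (_∘_; const)
open import Function.Bundles using (mk⇔)
open import Function.Definitions using (Injective; Surjective)

xorSum : ∀ {A : Set} → List A → (A → Bool) → Bool
xorSum l g = foldr (λ x acc → g x xor acc) false l

bit : Bool → ℕ
bit false = 0
bit true  = 1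

count : ∀ {A : Set} → List A → (A → Bool) → ℕ
count l g = sum (map (bit ∘ g) l)

odd : ℕ → Bool
odd zero    = false
odd (suc n) = not (odd n)

odd-+ : ∀ m n → odd (m + n) ≡ odd m xor odd n
odd-+ zero    n = refl
odd-+ (suc m) n = trans (cong not (odd-+ m n)) (not-distribˡ-xor (odd m) (odd n))

odd-2* : ∀ m → odd (2 * m) ≡ false
odd-2* m = begin
  odd (m + (m + 0))         ≡⟨ odd-+ m (m + 0) ⟩
  odd m xor odd (m + 0)     ≡⟨ cong (λ t → odd m xor odd t) (+-identityʳ m) ⟩
  odd m xor odd m           ≡⟨ xor-same (odd m) ⟩
  false                     ∎
  where open ≡-Reasoning

module _ {A : Set} where

  xorSum-++ : ∀ (l l′ : List A) g → xorSum (l ++ l′) g ≡ xorSum l g xor xorSum l′ g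
  xorSum-++ []      l′ g = refl
  xorSum-++ (x ∷ l) l′ g =
    trans (cong (g x xor_) (xorSum-++ l l′ g)) (sym (xor-assoc (g x) (xorSum l g) (xorSum l′ g)))

  xorSum-map : ∀ {B : Set} (h : A → B) (l : List A) g → xorSum (map h l) g ≡ xorSum l (g ∘ h)
  xorSum-map h []      g = refl
  xorSum-map h (x ∷ l) g = cong (g (h x) xor_) (xorSum-map h l g)

  xorSum-cong : ∀ (l : List A) {g h} → (∀ x → g x ≡ h x) → xorSum l g ≡ xorSum l h
  xorSum-cong []      g≗h = refl
  xorSum-cong (x ∷ l) g≗h = cong₂ _xor_ (g≗h x) (xorSum-cong l g≗h)

  xorSum-∧ˡ : ∀ (l : List A) b g → xorSum l (λ x → b ∧ g x) ≡ b ∧ xorSum l g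
  xorSum-∧ˡ []      false g = refl
  xorSum-∧ˡ []      true  g = refl
  xorSum-∧ˡ (x ∷ l) false g = xorSum-∧ˡ l false g
  xorSum-∧ˡ (x ∷ l) true  g = cong (g x xor_) (xorSum-∧ˡ l true g)

  xorSum-xor : ∀ (l : List A) g h → xorSum l (λ x → g x xor h x) ≡ xorSum l g xor xorSum l h
  xorSum-xor []      g h = refl
  xorSum-xor (x ∷ l) g h =
    trans (cong ((g x xor h x) xor_) (xorSum-xor l g h))
          (xor-interchange (g x) (h x) (xorSum l g) (xorSum l h))

  xorSum≡odd-count : ∀ (l : List A) g → xorSum l g ≡ odd (count l g)
  xorSum≡odd-count []      g = refl
  xorSum≡odd-count (x ∷ l) g with g x
  ... | false = xorSum≡odd-count l g
  ... | true  = cong not (xorSum≡odd-count l g)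

  count-++ : ∀ (l l′ : List A) g → count (l ++ l′) g ≡ count l g + count l′ g
  count-++ l l′ g = trans (cong sum (map-++ (bit ∘ g) l l′)) (sum-++ (map (bit ∘ g) l) _)

  count-map : ∀ {B : Set} (h : A → B) (l : List A) g → count (map h l) g ≡ count l (g ∘ h)
  count-map h l g = cong sum (sym (map-∘ l))

  count-cong : ∀ (l : List A) {g h} → (∀ x → g x ≡ h x) → count l g ≡ count l h
  count-cong l g≗h = cong sum (map-cong (cong bit ∘ g≗h) l)

xorSum-allVecs-suc : ∀ k (g : Vec Bool (suc k) → Bool) →
  xorSum (allVecs (suc k)) g ≡ xorSum (allVecs k) (g ∘ (false ∷_)) xor xorSum (allVecs k) (g ∘ (true ∷_))
xorSum-allVecs-suc k g =
  trans (xorSum-++ (map (false ∷_) (allVecs k)) _ g)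
        (cong₂ _xor_ (xorSum-map (false ∷_) (allVecs k) g) (xorSum-map (true ∷_) (allVecs k) g))

count-allVecs-suc : ∀ k (g : Vec Bool (suc k) → Bool) →
  count (allVecs (suc k)) g ≡ count (allVecs k) (g ∘ (false ∷_)) + count (allVecs k) (g ∘ (true ∷_))
count-allVecs-suc k g =
  trans (count-++ (map (false ∷_) (allVecs k)) _ g)
        (cong₂ _+_ (count-map (false ∷_) (allVecs k) g) (count-map (true ∷_) (allVecs k) g))

∈-allVecs : ∀ {k} (v : Vec Bool k) → v ∈ allVecs k
∈-allVecs []          = here refl
∈-allVecs (false ∷ v) = ∈-++⁺ˡ (∈-map⁺ (false ∷_) (∈-allVecs v))
∈-allVecs (true ∷ v)  = ∈-++⁺ʳ _ (∈-map⁺ (true ∷_) (∈-allVecs v))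

allVecs-unique : ∀ k → Unique (allVecs k)
allVecs-unique zero    = [] ∷ []
allVecs-unique (suc k) =
  Unique.++⁺ (Unique.map⁺ ∷-injectiveʳ (allVecs-unique k))
             (Unique.map⁺ ∷-injectiveʳ (allVecs-unique k)) disjoint
  where
  disjoint : ∀ {v} → ¬ (v ∈ map (false ∷_) (allVecs k) × v ∈ map (true ∷_) (allVecs k))
  disjoint (p , q) with ∈-map⁻ (false ∷_) p | ∈-map⁻ (true ∷_) q
  ... | _ , _ , refl | _ , _ , ()

count-∘-bijection : ∀ {k} (F : Vec Bool k → Vec Bool k) →
  Injective _≡_ _≡_ F → Surjective _≡_ _≡_ F →
  ∀ P → count (allVecs k) (P ∘ F) ≡ count (allVecs k) P
count-∘-bijection {k} F inj surj P =
  trans (sym (count-map F (allVecs k) P)) (sum-↭ (Perm.map⁺ (bit ∘ P) F[allVecs]↭allVecs))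
  where
  ∈-F[allVecs] : ∀ y → y ∈ map F (allVecs k)
  ∈-F[allVecs] y = subst (_∈ map F (allVecs k)) (proj₂ (surj y) refl)
                         (∈-map⁺ F (∈-allVecs (proj₁ (surj y))))
  F[allVecs]↭allVecs : map F (allVecs k) ↭ allVecs k
  F[allVecs]↭allVecs =
    ∼bag⇒↭ (unique∧set⇒bag (Unique.map⁺ inj (allVecs-unique k)) (allVecs-unique k)
              (mk⇔ (λ _ → ∈-allVecs _) (λ _ → ∈-F[allVecs] _)))

count-const : ∀ r b → count (allVecs r) (const b) ≡ 2 ^ r * bit b
count-const zero    b = refl
count-const (suc r) b = begin
  count (allVecs (suc r)) (const b)                          ≡⟨ count-allVecs-suc r (const b) ⟩
  count (allVecs r) (const b) + count (allVecs r) (const b)  ≡⟨ cong₂ _+_ (count-const r b) (count-const r b) ⟩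
  2 ^ r * bit b + 2 ^ r * bit b                              ≡⟨ cong (2 ^ r * bit b +_) (sym (+-identityʳ _)) ⟩
  2 * (2 ^ r * bit b)                                        ≡⟨ sym (*-assoc 2 (2 ^ r) (bit b)) ⟩
  2 ^ suc r * bit b                                          ∎
  where open ≡-Reasoning

count-∘take : ∀ k r (g : Vec Bool k → Bool) →
  count (allVecs (k + r)) (g ∘ take k) ≡ 2 ^ r * count (allVecs k) g
count-∘take zero    r g = trans (count-const r (g [])) (cong (2 ^ r *_) (sym (+-identityʳ _)))
count-∘take (suc k) r g = begin
  count (allVecs (suc k + r)) (g ∘ take (suc k))
    ≡⟨ count-allVecs-suc (k + r) (g ∘ take (suc k)) ⟩
  count (allVecs (k + r)) (g₀ ∘ take k) + count (allVecs (k + r)) (g₁ ∘ take k)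
    ≡⟨ cong₂ _+_ (count-∘take k r g₀) (count-∘take k r g₁) ⟩
  2 ^ r * count (allVecs k) g₀ + 2 ^ r * count (allVecs k) g₁
    ≡⟨ sym (*-distribˡ-+ (2 ^ r) _ _) ⟩
  2 ^ r * (count (allVecs k) g₀ + count (allVecs k) g₁)
    ≡⟨ cong (2 ^ r *_) (sym (count-allVecs-suc k g)) ⟩
  2 ^ r * count (allVecs (suc k)) g
    ∎
  where
  open ≡-Reasoning
  g₀ g₁ : Vec Bool k → Bool
  g₀ = g ∘ (false ∷_)
  g₁ = g ∘ (true ∷_)

count-head : ∀ m → count (allVecs (suc m)) (λ y → lookup y Fin.zero) ≡ 2 ^ m
count-head m =
  trans (count-allVecs-suc m (λ y → lookup y Fin.zero))
        (trans (cong₂ _+_ (count-const m false) (count-const m true))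
               (trans (cong (_+ 2 ^ m * 1) (*-zeroʳ (2 ^ m))) (*-identityʳ (2 ^ m))))

anf : ∀ {k} → BoolFun k → Vec Bool k → Bool
anf {zero}  f []          = f []
anf {suc k} f (false ∷ S) = anf (f ∘ (false ∷_)) S
anf {suc k} f (true ∷ S)  = anf (λ x → f (false ∷ x) xor f (true ∷ x)) S

evalANF-∷ : ∀ {k} (a : Vec Bool (suc k) → Bool) x₀ (x : Vec Bool k) →
  evalANF a (x₀ ∷ x) ≡ evalANF (a ∘ (false ∷_)) x xor (x₀ ∧ evalANF (a ∘ (true ∷_)) x)
evalANF-∷ {k} a x₀ x =
  trans (xorSum-allVecs-suc k (λ S → a S ∧ monomial S (x₀ ∷ x)))
        (cong (evalANF (a ∘ (false ∷_)) x xor_)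
              (trans (xorSum-cong (allVecs k) (λ S → ∧-leftComm (a (true ∷ S)) x₀ (monomial S x)))
                     (xorSum-∧ˡ (allVecs k) x₀ (λ S → a (true ∷ S) ∧ monomial S x))))

shannon : ∀ {k} (f : BoolFun (suc k)) b x →
  f (b ∷ x) ≡ f (false ∷ x) xor (b ∧ (f (false ∷ x) xor f (true ∷ x)))
shannon f false x = sym (xor-identityʳ (f (false ∷ x)))
shannon f true  x =
  sym (trans (sym (xor-assoc (f (false ∷ x)) _ _)) (cong (_xor f (true ∷ x)) (xor-same (f (false ∷ x)))))

anf-correct : ∀ {k} (f : BoolFun k) → IsANF f (anf f)
anf-correct {zero}  f []       = sym (trans (xor-identityʳ _) (∧-identityʳ (f [])))
anf-correct {suc k} f (x₀ ∷ x) = begin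
  f (x₀ ∷ x)                                                   ≡⟨ shannon f x₀ x ⟩
  f (false ∷ x) xor (x₀ ∧ (f (false ∷ x) xor f (true ∷ x)))    ≡⟨ cong₂ (λ u v → u xor (x₀ ∧ v))
                                                                        (anf-correct _ x) (anf-correct _ x) ⟩
  evalANF (anf f ∘ (false ∷_)) x xor (x₀ ∧ evalANF (anf f ∘ (true ∷_)) x)
                                                               ≡⟨ sym (evalANF-∷ (anf f) x₀ x) ⟩
  evalANF (anf f) (x₀ ∷ x)                                     ∎
  where open ≡-Reasoning

anf-top : ∀ k (f : BoolFun k) → anf f (replicate k true) ≡ xorSum (allVecs k) f
anf-top zero    f = sym (xor-identityʳ (f []))
anf-top (suc k) f = begin
  anf (λ x → f₀ x xor f₁ x) (replicate k true)                 ≡⟨ anf-top k _ ⟩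
  xorSum (allVecs k) (λ x → f₀ x xor f₁ x)                     ≡⟨ xorSum-xor (allVecs k) f₀ f₁ ⟩
  xorSum (allVecs k) f₀ xor xorSum (allVecs k) f₁              ≡⟨ sym (xorSum-allVecs-suc k f) ⟩
  xorSum (allVecs (suc k)) f                                   ∎
  where
  open ≡-Reasoning
  f₀ f₁ : BoolFun k
  f₀ = f ∘ (false ∷_)
  f₁ = f ∘ (true ∷_)

card≤ : ∀ {k} (S : Vec Bool k) → card S ≤ k
card≤ []          = z≤n
card≤ (false ∷ S) = m≤n⇒m≤1+n (card≤ S)
card≤ (true ∷ S)  = s≤s (card≤ S)

card≡⇒all-true : ∀ {k} (S : Vec Bool k) → card S ≡ k → S ≡ replicate k true
card≡⇒all-true []          _  = refl
card≡⇒all-true (false ∷ S) eq = ⊥-elim (<-irrefl refl (subst (_≤ _) eq (card≤ S)))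
card≡⇒all-true (true ∷ S)  eq = cong (true ∷_) (card≡⇒all-true S (suc-injective eq))

weight : ∀ {k} → BoolFun k → ℕ
weight {k} f = count (allVecs k) f

evenWeight⇒degree<arity : ∀ {k} (f : BoolFun k) → odd (weight f) ≡ false → DegreeLessThan f k
evenWeight⇒degree<arity {k} f even = anf f , anf-correct f , card<k
  where
  top-vanishes : anf f (replicate k true) ≡ false
  top-vanishes = trans (anf-top k f) (trans (xorSum≡odd-count (allVecs k) f) even)
  card<k : ∀ S → anf f S ≡ true → card S < k
  card<k S aS with m≤n⇒m<n∨m≡n (card≤ S)
  ... | inj₁ lt = lt
  ... | inj₂ eq with card≡⇒all-true S eq
  ... | refl with trans (sym aS) top-vanishes
  ... | ()

take≡window₀ : ∀ k r .{{_ : NonZero (k + r)}} (y : Vec Bool (k + r)) →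
  tabulate (λ (j : Fin k) → lookup y (toℕ j mod (k + r))) ≡ take k y
take≡window₀ k r y = trans (tabulate-cong lookup-mod) (tabulate∘lookup (take k y))
  where
  lookup-mod : ∀ j → lookup y (toℕ j mod (k + r)) ≡ lookup (take k y) j
  lookup-mod j = trans (cong (lookup y) (toℕ-injective (begin
    toℕ (toℕ j mod (k + r))               ≡⟨ toℕ-fromℕ< _ ⟩
    toℕ j % (k + r)                       ≡⟨ m<n⇒m%n≡m (<-≤-trans (toℕ<n j) (m≤m+n k r)) ⟩
    toℕ j                                 ≡⟨ sym (toℕ-inject≤ j (m≤m+n k r)) ⟩
    toℕ (inject≤ j (m≤m+n k r))           ∎)))
    (sym (lookup-take-inject≤ y j))
    where open ≡-Reasoning

induced-head : ∀ k r (f : BoolFun (suc k)) (y : Vec Bool (suc k + r)) →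
  lookup (induced (suc k + r) f y) Fin.zero ≡ f (take (suc k) y)
induced-head k r f y = trans (lookup∘tabulate window Fin.zero) (cong f (take≡window₀ (suc k) r y))
  where
  window : Fin (suc k + r) → Bool
  window i = f (tabulate λ j → lookup y ((toℕ i + toℕ j) mod (suc k + r)))

lifting⇒balanced : ∀ k r (f : BoolFun (suc k)) → IsLifting (suc k) (suc k + r) f → weight f ≡ 2 ^ k
lifting⇒balanced k r f (inj , surj) = *-cancelˡ-≡ (weight f) (2 ^ k) (2 ^ r) {{m^n≢0 2 r}} (begin
  2 ^ r * weight f                                          ≡⟨ sym (count-∘take (suc k) r f) ⟩
  count (allVecs n) (f ∘ take (suc k))                      ≡⟨ count-cong (allVecs n) (sym ∘ induced-head k r f) ⟩
  count (allVecs n) (λ y → lookup (F y) Fin.zero)           ≡⟨ count-∘-bijection F inj surj (λ y → lookup y Fin.zero) ⟩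
  count (allVecs n) (λ y → lookup y Fin.zero)               ≡⟨ count-head (k + r) ⟩
  2 ^ (k + r)                                               ≡⟨ ^-distribˡ-+-* 2 k r ⟩
  2 ^ k * 2 ^ r                                             ≡⟨ *-comm (2 ^ k) (2 ^ r) ⟩
  2 ^ r * 2 ^ k                                             ∎)
  where
  open ≡-Reasoning
  n : ℕ
  n = suc k + r
  F : Vec Bool n → Vec Bool n
  F = induced n f

mainTheorem4 : (k n : ℕ) .{{_ : NonZero n}} → 3 ≤ k → k ≤ n →
    (f : BoolFun k) → IsLifting k n f → DegreeLessThan f k
mainTheorem4 (suc (suc k)) n (s≤s (s≤s _)) k≤n f lifting with m≤n⇒∃[o]m+o≡n k≤n
... | r , refl = evenWeight⇒degree<arity f (begin
  odd (weight f)        ≡⟨ cong odd (lifting⇒balanced (suc k) r f lifting) ⟩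
  odd (2 * 2 ^ k)       ≡⟨ odd-2* (2 ^ k) ⟩
  false                 ∎)
  where open ≡-Reasoning
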